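{- Let $n,k,l$ be integers with $n\ge 2$, $k\ge n-1$ and $l\ge 1$. Suppose $[-k,\,k+2l]^*$ splits the cyclic group $\mathbb{Z}_{n(2k+2l)+1}$, and let $s$ and $s'$ be two elements of a splitter set. Then one of the following holds: (a) there are integers $x,y$ with $1\le x\le 2n+2l-3$ and $1\le |y|\le k$ such that $xs+ys'=0$; (b) $s'=\pm(2n+2l-2)s$, $k=n-1$ or $l=1$, and $s$ is a generator of $\mathbb{Z}_{n(2k+2l)+1}$.
   Context: For integers $a\le b$, $[a,b]^*=\{a,\dots,b\}\setminus\{0\}$. A set of integers $M$ splits an additive finite abelian group $G$ with splitter set $S\subseteq G$ if every nonzero $g\in G$ has a unique representation $g=ms$ with $m\in M$, $s\in S$, while $0$ has no such representation; here $ms$ is the $m$-fold sum of $s$ for $m\ge0$ and $-((-m)s)$ for $m<0$. -}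

module Defs where

open import Data.Nat as ℕ using (ℕ; suc; _%_)
open import Data.Nat.DivMod using (m%n<n)
open import Data.Integer as ℤ using (ℤ; +_)
open import Data.Integer.DivMod using (_%ℕ_; n%ℕd<d)
open import Data.Fin using (Fin; toℕ; fromℕ<) renaming (zero to fzero)
open import Data.Product using (Σ; _×_)
open import Relation.Binary.PropositionalEquality using (_≡_; _≢_)
open import Relation.Nullary using (¬_)

-- The cyclic group ℤ_N with N = suc N', elements represented by Fin (suc N')
-- (residues 0 … N'), with addition mod N.
ZMod : ℕ → Set
ZMod N' = Fin (suc N')

0Z : ∀ {N'} → ZMod N'
0Z = fzero

addZ : ∀ {N'} → ZMod N' → ZMod N' → ZMod N'
addZ {N'} a b = fromℕ< (m%n<n (toℕ a ℕ.+ toℕ b) (suc N'))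

-- m·s for m ∈ ℤ, s ∈ ℤ_N : the residue of m * s mod N
-- (equals the m-fold sum of s for m ≥ 0 and -((-m) s) for m < 0).
smul : ∀ {N'} → ℤ → ZMod N' → ZMod N'
smul {N'} m s = fromℕ< (n%ℕd<d (m ℤ.* + toℕ s) (suc N'))

Interval* : ℤ → ℤ → ℤ → Set
Interval* a b m = (a ℤ.≤ m × m ℤ.≤ b) × m ≢ + 0

Splits : (N' : ℕ) → (ℤ → Set) → (ZMod N' → Set) → Set
Splits N' M S =
  (∀ (g : ZMod N') → g ≢ 0Z →
     Σ ℤ λ m → Σ (ZMod N') λ s → M m × S s × smul m s ≡ g)
  × (∀ (g : ZMod N') → g ≢ 0Z → ∀ m s m′ s′ → M m → S s → M m′ → S s′ →
       smul m s ≡ g → smul m′ s′ ≡ g → m ≡ m′ × s ≡ s′)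
  × (∀ m (s : ZMod N') → M m → S s → smul m s ≢ 0Z)

IsGenerator : ∀ {N'} → ZMod N' → Set
IsGenerator {N'} s = ∀ (g : ZMod N') → Σ ℤ λ t → smul t s ≡ g

-- Let s, s′ be splitter elements and suppose there is no short relation x s + y s′ = 0
-- (1 ≤ x ≤ A := 2n + 2l − 3, 1 ≤ |y| ≤ k).  Every splitter element has order exceeding
-- 2k + 2l, so the residues x s + y s′ with 0 ≤ x ≤ A, 0 ≤ y ≤ k are then pairwise
-- distinct: a box of (A + 1)(k + 1) residues inside ℤ_N, N = n(2k + 2l) + 1.  When n ≤ k
-- and l ≥ 2 the box is larger than N, a contradiction.  When k = n − 1 or l = 1 it has
-- exactly N − 1 elements, so it misses a single residue.  Then among the k + 1 distinct
-- residues (A + 1) s + j s′ at most one lies outside the box, and those inside the box are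
-- forced onto the s′-axis with one common offset: (A + 1) s = δ s′.  Counting which j
-- leave the box gives δ = ±1, i.e. s′ = ±(A + 1) s, and since the box together with the
-- missing residue is everything, s generates ℤ_N.
module Submission where

open import Defs
open import Data.Empty using (⊥; ⊥-elim)
open import Data.Fin as Fin using (Fin; toℕ; fromℕ<; remQuot; combine)
open import Data.Fin.Properties
  using (toℕ-fromℕ<; toℕ-injective; toℕ≤pred[n]; any?; injective⇒≤; combine-remQuot)
open import Data.Integer as ℤ using (ℤ; +_; -_; -[1+_]; +[1+_]; 0ℤ; ∣_∣)
import Data.Integer.Properties as ℤP
open import Data.Integer.Divisibility.Signed
  using (_∣_; _∣?_; divides; ∣⇒∣ᵤ; ∣m∣n⇒∣m+n; ∣m∣n⇒∣m-n; ∣m⇒∣-m; ∣n⇒∣m*n)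
open import Data.Integer.DivMod using (_%ℕ_; _/ℕ_; n%ℕd<d; a≡a%ℕn+[a/ℕn]*n)
open import Data.Nat as ℕ using (ℕ; zero; suc; _≤_; _<_; z≤n; s≤s)
open import Data.Nat.Divisibility using (>⇒∤)
import Data.Nat.Properties as ℕP
open import Data.Nat.Properties using (anyUpTo?)
open import Data.Product as Product using (Σ; ∃; _×_; _,_; proj₁; proj₂)
open import Data.Sum as Sum using (_⊎_; inj₁; inj₂)
open import Function using (_∘_; id; case_of_)
open import Function.Definitions using (Injective)
open import Relation.Binary.PropositionalEquality
open import Relation.Nullary using (¬_; contradiction; Dec; yes; no)
open import Relation.Nullary.Decidable using (map′; toSum; _×-dec_; _⊎-dec_)
open import Relation.Unary using (Decidable)

m+n≤m⇒n≡0 : ∀ {m n} → m ℕ.+ n ≤ m → n ≡ 0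
m+n≤m⇒n≡0 {m} {n} m+n≤m =
  ℕP.n≤0⇒n≡0 (ℕP.+-cancelˡ-≤ m n 0 (subst (m ℕ.+ n ≤_) (sym (ℕP.+-identityʳ m)) m+n≤m))

m+n≤1+m⇒n≤1 : ∀ {m n} → m ℕ.+ n ≤ suc m → n ≤ 1
m+n≤1+m⇒n≤1 {m} {n} m+n≤1+m =
  ℕP.+-cancelˡ-≤ m n 1 (subst (m ℕ.+ n ≤_) (sym (ℕP.+-comm m 1)) m+n≤1+m)

∣[+m]-[+n]∣≤ : ∀ {m n b} → m ≤ b → n ≤ b → ∣ + m ℤ.- + n ∣ ≤ b
∣[+m]-[+n]∣≤ {m} {n} m≤b n≤b =
  subst (_≤ _) (cong ∣_∣ (sym (ℤP.[+m]-[+n]≡m⊖n m n)))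
        (ℕP.≤-trans (ℤP.∣m⊝n∣≤m⊔n m n) (ℕP.⊔-lub m≤b n≤b))

[+m]-[+n]≡0⇒m≡n : ∀ {m n} → + m ℤ.- + n ≡ 0ℤ → m ≡ n
[+m]-[+n]≡0⇒m≡n = ℤP.+-injective ∘ ℤP.i-j≡0⇒i≡j _ _

n∣i∧∣i∣<n⇒i≡0 : ∀ {n i} → + n ∣ i → ∣ i ∣ < n → i ≡ 0ℤ
n∣i∧∣i∣<n⇒i≡0 {i = + zero}   _   _     = refl
n∣i∧∣i∣<n⇒i≡0 {i = +[1+ _ ]} n∣i ∣i∣<n = contradiction (∣⇒∣ᵤ n∣i) (>⇒∤ ∣i∣<n)
n∣i∧∣i∣<n⇒i≡0 {i = -[1+ _ ]} n∣i ∣i∣<n = contradiction (∣⇒∣ᵤ n∣i) (>⇒∤ ∣i∣<n)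

injective⇒hitsOneOf : ∀ {m n} {f : Fin m → Fin n} → Injective _≡_ _≡_ f → n ≤ suc m →
                      ∀ {p q} → p ≢ q → (∃ λ i → f i ≡ p) ⊎ (∃ λ i → f i ≡ q)
injective⇒hitsOneOf {m} {n} {f} f-injective n≤1+m {p} {q} p≢q
  with any? (λ i → f i Fin.≟ p) | any? (λ i → f i Fin.≟ q)
... | yes hit   | _         = inj₁ hit
... | no _      | yes hit   = inj₂ hit
... | no ¬hit-p | no ¬hit-q = contradiction (injective⇒≤ g-injective) (ℕP.<⇒≱ (s≤s n≤1+m))
  where
  g : Fin (suc (suc m)) → Fin n
  g Fin.zero              = p
  g (Fin.suc Fin.zero)    = q
  g (Fin.suc (Fin.suc i)) = f i

  g-injective : Injective _≡_ _≡_ g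
  g-injective {Fin.zero}            {Fin.zero}            _  = refl
  g-injective {Fin.zero}            {Fin.suc Fin.zero}    eq = ⊥-elim (p≢q eq)
  g-injective {Fin.zero}            {Fin.suc (Fin.suc j)} eq = ⊥-elim (¬hit-p (j , sym eq))
  g-injective {Fin.suc Fin.zero}    {Fin.zero}            eq = ⊥-elim (p≢q (sym eq))
  g-injective {Fin.suc Fin.zero}    {Fin.suc Fin.zero}    _  = refl
  g-injective {Fin.suc Fin.zero}    {Fin.suc (Fin.suc j)} eq = ⊥-elim (¬hit-q (j , sym eq))
  g-injective {Fin.suc (Fin.suc i)} {Fin.zero}            eq = ⊥-elim (¬hit-p (i , eq))
  g-injective {Fin.suc (Fin.suc i)} {Fin.suc Fin.zero}    eq = ⊥-elim (¬hit-q (i , eq))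
  g-injective {Fin.suc (Fin.suc i)} {Fin.suc (Fin.suc j)} eq = cong (Fin.suc ∘ Fin.suc) (f-injective eq)

module Modular (N′ : ℕ) where
  open import Data.Integer using (_+_; _-_; _*_)
  open import Data.Integer.Tactic.RingSolver using (solve-∀)

  N : ℕ
  N = suc N′

  ι : ZMod N′ → ℤ
  ι g = + toℕ g

  -- smul m a and addZ a b are definitionally ⟦ m * ι a ⟧ and ⟦ ι a + ι b ⟧, so all the
  -- group arithmetic below is integer arithmetic on representatives, modulo N.
  ⟦_⟧ : ℤ → ZMod N′
  ⟦ z ⟧ = fromℕ< (n%ℕd<d z N)

  N∣ι⟦z⟧-z : ∀ z → + N ∣ ι ⟦ z ⟧ - z
  N∣ι⟦z⟧-z z = divides (- (z /ℕ N)) (begin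
    ι ⟦ z ⟧ - z                              ≡⟨ cong₂ _-_ (cong +_ (toℕ-fromℕ< _)) (a≡a%ℕn+[a/ℕn]*n z N) ⟩
    + (z %ℕ N) - (+ (z %ℕ N) + z /ℕ N * + N) ≡⟨ cancel (+ (z %ℕ N)) (z /ℕ N) (+ N) ⟩
    - (z /ℕ N) * + N                         ∎)
    where
    open ≡-Reasoning
    cancel : ∀ r q n → r - (r + q * n) ≡ - q * n
    cancel = solve-∀

  ∣ι-ι⇒≡ : ∀ {g h} → + N ∣ ι g - ι h → g ≡ h
  ∣ι-ι⇒≡ {g} {h} N∣g-h = toℕ-injective ([+m]-[+n]≡0⇒m≡n
    (n∣i∧∣i∣<n⇒i≡0 N∣g-h (s≤s (∣[+m]-[+n]∣≤ (toℕ≤pred[n] g) (toℕ≤pred[n] h)))))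

  ⟦⟧-≡⇒∣ : ∀ a b → ⟦ a ⟧ ≡ ⟦ b ⟧ → + N ∣ a - b
  ⟦⟧-≡⇒∣ a b ⟦a⟧≡⟦b⟧ = subst (+ N ∣_) (cancel (ι ⟦ b ⟧) a b)
    (∣m∣n⇒∣m-n (N∣ι⟦z⟧-z b) (subst (λ u → + N ∣ u - a) (cong ι ⟦a⟧≡⟦b⟧) (N∣ι⟦z⟧-z a)))
    where
    cancel : ∀ u a b → (u - b) - (u - a) ≡ a - b
    cancel = solve-∀

  ∣⇒⟦⟧-≡ : ∀ a b → + N ∣ a - b → ⟦ a ⟧ ≡ ⟦ b ⟧
  ∣⇒⟦⟧-≡ a b N∣a-b = ∣ι-ι⇒≡ (subst (+ N ∣_) (cancel (ι ⟦ a ⟧) (ι ⟦ b ⟧) a b)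
    (∣m∣n⇒∣m+n (∣m∣n⇒∣m-n (N∣ι⟦z⟧-z a) (N∣ι⟦z⟧-z b)) N∣a-b))
    where
    cancel : ∀ u v a b → (u - a) - (v - b) + (a - b) ≡ u - v
    cancel = solve-∀

  ⟦ι[g]⟧≡g : ∀ g → ⟦ ι g ⟧ ≡ g
  ⟦ι[g]⟧≡g g = ∣ι-ι⇒≡ (N∣ι⟦z⟧-z (ι g))

  ∣⇒smul≡ : ∀ m a g → + N ∣ m * ι a - ι g → smul m a ≡ g
  ∣⇒smul≡ m a g N∣ = trans (∣⇒⟦⟧-≡ (m * ι a) (ι g) N∣) (⟦ι[g]⟧≡g g)

  ∣⇒smul≡0Z : ∀ m a → + N ∣ m * ι a → smul m a ≡ 0Z
  ∣⇒smul≡0Z m a N∣ = ∣⇒⟦⟧-≡ (m * ι a) 0ℤ (subst (+ N ∣_) (sym (ℤP.+-identityʳ (m * ι a))) N∣)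

  ∣⇒addZ-smul≡0Z : ∀ x y a b → + N ∣ x * ι a + y * ι b → addZ (smul x a) (smul y b) ≡ 0Z
  ∣⇒addZ-smul≡0Z x y a b N∣ = ∣⇒⟦⟧-≡ (ι (smul x a) + ι (smul y b)) 0ℤ
    (subst (+ N ∣_) (cancel (ι (smul x a)) (ι (smul y b)) (x * ι a) (y * ι b))
           (∣m∣n⇒∣m+n (∣m∣n⇒∣m+n (N∣ι⟦z⟧-z (x * ι a)) (N∣ι⟦z⟧-z (y * ι b))) N∣))
    where
    cancel : ∀ u v p q → (u - p) + (v - q) + (p + q) ≡ (u + v) - 0ℤ
    cancel = solve-∀

  OrderExceeds : ℕ → ℤ → Set
  OrderExceeds B s = ∀ c → ∣ c ∣ ≤ B → + N ∣ c * s → c ≡ 0ℤ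

  OrderExceeds-anti : ∀ {B B′ s} → B′ ≤ B → OrderExceeds B s → OrderExceeds B′ s
  OrderExceeds-anti B′≤B ord c ∣c∣≤B′ = ord c (ℕP.≤-trans ∣c∣≤B′ B′≤B)

  Independent : ℕ → ℕ → ℤ → ℤ → Set
  Independent A k s₀ s₁ =
    ∀ a b → ∣ a ∣ ≤ A → ∣ b ∣ ≤ k → + N ∣ a * s₀ + b * s₁ → a ≡ 0ℤ × b ≡ 0ℤ

  ShortRelation : ℕ → ℕ → ZMod N′ → ZMod N′ → Set
  ShortRelation A k a b = Σ ℕ λ x → Σ ℤ λ y →
    1 ≤ x × x ≤ A × 1 ≤ ∣ y ∣ × ∣ y ∣ ≤ k × addZ (smul (+ x) a) (smul y b) ≡ 0Z

  ShortCoefficient : ℕ → (ℤ → Set) → Set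
  ShortCoefficient k P = ∃ λ y → 1 ≤ ∣ y ∣ × ∣ y ∣ ≤ k × P y

  shortCoefficient? : ∀ {P : ℤ → Set} → Decidable P → ∀ k → Dec (ShortCoefficient k P)
  shortCoefficient? {P} P? k =
    map′ fromSearch toSearch (anyUpTo? (λ j → 1 ℕ.≤? j ×-dec (P? (+ j) ⊎-dec P? (- + j))) (suc k))
    where
    Search : Set
    Search = ∃ λ j → j < suc k × 1 ≤ j × (P (+ j) ⊎ P (- + j))
    fromSearch : Search → ShortCoefficient k P
    fromSearch (j , s≤s j≤k , 1≤j , inj₁ P+j) = + j , 1≤j , j≤k , P+j
    fromSearch (j , s≤s j≤k , 1≤j , inj₂ P-j) =
      - + j , subst (1 ≤_) (sym (ℤP.∣-i∣≡∣i∣ (+ j))) 1≤j ,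
      subst (_≤ k) (sym (ℤP.∣-i∣≡∣i∣ (+ j))) j≤k , P-j
    toSearch : ShortCoefficient k P → Search
    toSearch (+ j      , 1≤j , j≤k , P+j) = j , s≤s j≤k , 1≤j , inj₁ P+j
    toSearch (-[1+ j ] , 1≤j , j≤k , P-j) = suc j , s≤s j≤k , 1≤j , inj₂ P-j

  shortRelation? : ∀ A k a b → Dec (ShortRelation A k a b)
  shortRelation? A k a b = map′ fromSearch toSearch
    (anyUpTo? (λ x → 1 ℕ.≤? x ×-dec shortCoefficient? (λ y → addZ (smul (+ x) a) (smul y b) Fin.≟ 0Z) k) (suc A))
    where
    Search : Set
    Search = ∃ λ x → x < suc A × 1 ≤ x × ShortCoefficient k (λ y → addZ (smul (+ x) a) (smul y b) ≡ 0Z)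
    fromSearch : Search → ShortRelation A k a b
    fromSearch (x , s≤s x≤A , 1≤x , y , 1≤∣y∣ , ∣y∣≤k , rel) =
      x , y , 1≤x , x≤A , 1≤∣y∣ , ∣y∣≤k , rel
    toSearch : ShortRelation A k a b → Search
    toSearch (x , y , 1≤x , x≤A , 1≤∣y∣ , ∣y∣≤k , rel) =
      x , s≤s x≤A , 1≤x , y , 1≤∣y∣ , ∣y∣≤k , rel

  independent : ∀ {A k a b} → OrderExceeds A (ι a) → OrderExceeds k (ι b) → ¬ ShortRelation A k a b →
                Independent A k (ι a) (ι b)
  independent {A} {k} {a} {b} ord₀ ord₁ ¬rel = signed
    where
    drop₀ : ∀ y s t → + 0 * s + y * t ≡ y * t
    drop₀ = solve-∀
    drop₁ : ∀ x s t → x * s + + 0 * t ≡ x * s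
    drop₁ = solve-∀
    negate : ∀ x y s t → - (x * s + y * t) ≡ (- x) * s + (- y) * t
    negate = solve-∀
    nonnegative : ∀ x y → x ≤ A → ∣ y ∣ ≤ k → + N ∣ + x * ι a + y * ι b → + x ≡ 0ℤ × y ≡ 0ℤ
    nonnegative zero y _ ∣y∣≤k N∣ = refl , ord₁ y ∣y∣≤k (subst (+ N ∣_) (drop₀ y (ι a) (ι b)) N∣)
    nonnegative (suc x) (+ zero) x<A _ N∣ =
      case ord₀ (+ suc x) x<A (subst (+ N ∣_) (drop₁ (+ suc x) (ι a) (ι b)) N∣) of λ ()
    nonnegative (suc x) y@(+[1+ _ ]) x<A ∣y∣≤k N∣ =
      ⊥-elim (¬rel (suc x , y , s≤s z≤n , x<A , s≤s z≤n , ∣y∣≤k , ∣⇒addZ-smul≡0Z (+ suc x) y a b N∣))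
    nonnegative (suc x) y@(-[1+ _ ]) x<A ∣y∣≤k N∣ =
      ⊥-elim (¬rel (suc x , y , s≤s z≤n , x<A , s≤s z≤n , ∣y∣≤k , ∣⇒addZ-smul≡0Z (+ suc x) y a b N∣))
    signed : Independent A k (ι a) (ι b)
    signed (+ x)      y ∣x∣≤A ∣y∣≤k N∣ = nonnegative x y ∣x∣≤A ∣y∣≤k N∣
    signed (-[1+ x ]) y ∣x∣≤A ∣y∣≤k N∣ =
      case nonnegative (suc x) (- y) ∣x∣≤A (subst (_≤ k) (sym (ℤP.∣-i∣≡∣i∣ y)) ∣y∣≤k)
                       (subst (+ N ∣_) (negate -[1+ x ] y (ι a) (ι b)) (∣m⇒∣-m N∣)) of λ ()

  +∈Interval* : ∀ {a b c} → 1 ≤ c → c ≤ b → Interval* (- + a) (+ b) (+ c)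
  +∈Interval* {c = suc _} _ c≤b = (ℤP.neg-≤-pos , ℤ.+≤+ c≤b) , λ ()

  -∈Interval* : ∀ {a b e} → 1 ≤ e → e ≤ a → Interval* (- + a) (+ b) (- + e)
  -∈Interval* {e = suc _} _ e≤a = (ℤP.neg-mono-≤ (ℤ.+≤+ e≤a) , ℤP.neg-≤-pos) , λ ()

  splitter-orderExceeds : ∀ {a b S s} → Splits N′ (Interval* (- + a) (+ b)) S → 1 ≤ b → S s →
                          OrderExceeds (a ℕ.+ b) (ι s)
  splitter-orderExceeds {a} {b} {S} {s} (_ , unique , nonzero) 1≤b Ss = signed
    where
    b∈M : Interval* (- + a) (+ b) (+ b)
    b∈M = +∈Interval* 1≤b ℕP.≤-refl
    -- For b < c ≤ a + b, the element b s has the second representation (b − c) s.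
    positive : ∀ c → 1 ≤ c → c ≤ a ℕ.+ b → ¬ + N ∣ + c * ι s
    positive c 1≤c c≤a+b N∣ with c ℕ.≤? b
    ... | yes c≤b = nonzero (+ c) s (+∈Interval* 1≤c c≤b) Ss (∣⇒smul≡0Z (+ c) s N∣)
    ... | no c≰b with ℕP.m≤n⇒∃[o]m+o≡n (ℕP.≰⇒> c≰b)
    ... | e , refl =
      case proj₁ (unique (smul (+ b) s) (nonzero (+ b) s b∈M Ss) (+ b) s (- + suc e) s b∈M Ss -e∈M Ss
                         refl (sym bs≡-es)) of λ ()
      where
      -e∈M : Interval* (- + a) (+ b) (- + suc e)
      -e∈M = -∈Interval* (s≤s z≤n)
        (ℕP.+-cancelʳ-≤ b (suc e) a (subst (_≤ a ℕ.+ b) (cong suc (ℕP.+-comm b e)) c≤a+b))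
      split : ∀ b e t → (+ 1 + b + e) * t ≡ b * t - (- (+ 1 + e)) * t
      split = solve-∀
      bs≡-es : smul (+ b) s ≡ smul (- + suc e) s
      bs≡-es = ∣⇒⟦⟧-≡ (+ b * ι s) (- + suc e * ι s) (subst (+ N ∣_) (split (+ b) (+ e) (ι s)) N∣)
    signed : OrderExceeds (a ℕ.+ b) (ι s)
    signed (+ zero)   _     _  = refl
    signed (+[1+ c ]) c≤a+b N∣ = ⊥-elim (positive (suc c) (s≤s z≤n) c≤a+b N∣)
    signed (-[1+ c ]) c≤a+b N∣ = ⊥-elim (positive (suc c) (s≤s z≤n) c≤a+b
                                          (subst (+ N ∣_) (ℤP.neg-distribˡ-* -[1+ c ] (ι s)) (∣m⇒∣-m N∣)))

  comb∈⟨s₀⟩ : ∀ {s₀ s₁ c w} x y → + N ∣ c * s₀ - s₁ → + N ∣ w - (+ x * s₀ + + y * s₁) →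
              + N ∣ (+ x + + y * c) * s₀ - w
  comb∈⟨s₀⟩ {s₀} {s₁} {c} {w} x y N∣cs₀-s₁ N∣w-comb =
    subst (+ N ∣_) (regroup (+ x) (+ y) c s₀ s₁ w) (∣m∣n⇒∣m-n (∣n⇒∣m*n (+ y) N∣cs₀-s₁) N∣w-comb)
    where
    regroup : ∀ x y c s t w → y * (c * s - t) - (w - (x * s + y * t)) ≡ (x + y * c) * s - w
    regroup = solve-∀

  module Box (s₀ s₁ : ℤ) (A k : ℕ) where

    comb : ℕ → ℕ → ℤ
    comb x y = + x * s₀ + + y * s₁

    coordinates : Fin (suc A ℕ.* suc k) → Fin (suc A) × Fin (suc k)
    coordinates = remQuot (suc k)

    box : Fin (suc A ℕ.* suc k) → ZMod N′
    box i = let (x , y) = coordinates i in ⟦ comb (toℕ x) (toℕ y) ⟧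

    module _ (indep : Independent A k s₀ s₁) where

      comb-injective : ∀ x x′ y y′ → x ≤ A → x′ ≤ A → y ≤ k → y′ ≤ k →
                       + N ∣ comb x y - comb x′ y′ → x ≡ x′ × y ≡ y′
      comb-injective x x′ y y′ x≤A x′≤A y≤k y′≤k N∣ =
        Product.map [+m]-[+n]≡0⇒m≡n [+m]-[+n]≡0⇒m≡n
          (indep (+ x - + x′) (+ y - + y′) (∣[+m]-[+n]∣≤ x≤A x′≤A) (∣[+m]-[+n]∣≤ y≤k y′≤k)
                 (subst (+ N ∣_) (difference (+ x) (+ x′) (+ y) (+ y′) s₀ s₁) N∣))
        where
        difference : ∀ x x′ y y′ s t → (x * s + y * t) - (x′ * s + y′ * t) ≡ (x - x′) * s + (y - y′) * t
        difference = solve-∀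

      box-injective : Injective _≡_ _≡_ box
      box-injective {i} {j} boxi≡boxj =
        let (x , y) = coordinates i
            (x′ , y′) = coordinates j
            (x≡x′ , y≡y′) = comb-injective (toℕ x) (toℕ x′) (toℕ y) (toℕ y′)
              (toℕ≤pred[n] x) (toℕ≤pred[n] x′) (toℕ≤pred[n] y) (toℕ≤pred[n] y′)
              (⟦⟧-≡⇒∣ (comb (toℕ x) (toℕ y)) (comb (toℕ x′) (toℕ y′)) boxi≡boxj)
        in trans (sym (combine-remQuot {suc A} (suc k) i))
                 (trans (cong₂ combine (toℕ-injective x≡x′) (toℕ-injective y≡y′)) (combine-remQuot (suc k) j))

      box-size≤ : suc A ℕ.* suc k ≤ N
      box-size≤ = injective⇒≤ box-injective

      module Tight (ord₀ : OrderExceeds (suc A) s₀) (ord₁ : OrderExceeds (k ℕ.+ k) s₁) (1≤k : 1 ≤ k)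
                   (tight : suc A ℕ.* suc k ≡ N′) where

        s₁≡±[1+A]s₀ : Set
        s₁≡±[1+A]s₀ = (+ N ∣ + suc A * s₀ - s₁) ⊎ (+ N ∣ - + suc A * s₀ - s₁)

        InBox : ℤ → Set
        InBox w = Σ ℕ λ x → Σ ℕ λ y → x ≤ A × y ≤ k × + N ∣ w - comb x y

        inBox-either : ∀ v w → ¬ + N ∣ v - w → InBox v ⊎ InBox w
        inBox-either v w N∤v-w =
          Sum.map (inBox v) (inBox w)
            (injective⇒hitsOneOf box-injective (ℕP.≤-reflexive (cong suc (sym tight))) (N∤v-w ∘ ⟦⟧-≡⇒∣ v w))
          where
          inBox : ∀ u → ∃ (λ i → box i ≡ ⟦ u ⟧) → InBox u
          inBox u (i , boxi≡⟦u⟧) =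
            let (x , y) = coordinates i
            in toℕ x , toℕ y , toℕ≤pred[n] x , toℕ≤pred[n] y ,
               ⟦⟧-≡⇒∣ u (comb (toℕ x) (toℕ y)) (sym boxi≡⟦u⟧)

        column : ℕ → ℤ
        column j = comb (suc A) j

        OnAxis : ℕ → ℕ → Set
        OnAxis j y = + N ∣ column j - comb 0 y

        column-inBox⇒onAxis : ∀ {j} → j ≤ k → InBox (column j) → Σ ℕ λ y → y ≤ k × OnAxis j y
        column-inBox⇒onAxis j≤k (zero , y , _ , y≤k , N∣) = y , y≤k , N∣
        column-inBox⇒onAxis {j} j≤k (suc x , y , x<A , y≤k , N∣) =
          contradiction (proj₁ (comb-injective A x j y ℕP.≤-refl (ℕP.<⇒≤ x<A) j≤k y≤k
                                  (subst (+ N ∣_) (shift (+ A) (+ x) (+ j) (+ y) s₀ s₁) N∣)))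
                        (ℕP.<⇒≢ x<A ∘ sym)
          where
          shift : ∀ a x j y s t →
                  ((+ 1 + a) * s + j * t) - ((+ 1 + x) * s + y * t) ≡ (a * s + j * t) - (x * s + y * t)
          shift = solve-∀

        onAxis-aligned : ∀ {j y j′ y′} → j ≤ k → y ≤ k → j′ ≤ k → y′ ≤ k →
                         OnAxis j y → OnAxis j′ y′ → j ℕ.+ y′ ≡ j′ ℕ.+ y
        onAxis-aligned {j} {y} {j′} {y′} j≤k y≤k j′≤k y′≤k N∣ N∣′ =
          [+m]-[+n]≡0⇒m≡n (ord₁ (+ (j ℕ.+ y′) - + (j′ ℕ.+ y))
                                (∣[+m]-[+n]∣≤ (ℕP.+-mono-≤ j≤k y′≤k) (ℕP.+-mono-≤ j′≤k y≤k))
                                (subst (+ N ∣_) (difference (+ suc A) (+ j) (+ y) (+ j′) (+ y′) s₀ s₁)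
                                       (∣m∣n⇒∣m-n N∣ N∣′)))
          where
          difference : ∀ a j y j′ y′ s t →
                       ((a * s + j * t) - (+ 0 * s + y * t)) - ((a * s + j′ * t) - (+ 0 * s + y′ * t))
                       ≡ ((j + y′) - (j′ + y)) * t
          difference = solve-∀

        onAxis⇒≢ : ∀ {j y} → OnAxis j y → j ≢ y
        onAxis⇒≢ {j} N∣ refl =
          case ord₀ (+ suc A) ℕP.≤-refl (subst (+ N ∣_) (cancel (+ suc A) (+ j) s₀ s₁) N∣) of λ ()
          where
          cancel : ∀ a j s t → (a * s + j * t) - (+ 0 * s + j * t) ≡ a * s
          cancel = solve-∀

        columns-distinct : ∀ {j j′} → j ≤ k → j′ ≤ k → j ≢ j′ → ¬ + N ∣ column j - column j′
        columns-distinct {j} {j′} j≤k j′≤k j≢j′ N∣ =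
          j≢j′ ([+m]-[+n]≡0⇒m≡n
                  (ord₁ (+ j - + j′) (∣[+m]-[+n]∣≤ (ℕP.m≤n⇒m≤n+o k j≤k) (ℕP.m≤n⇒m≤n+o k j′≤k))
                        (subst (+ N ∣_) (difference (+ suc A) (+ j) (+ j′) s₀ s₁) N∣)))
          where
          difference : ∀ a j j′ s t → (a * s + j * t) - (a * s + j′ * t) ≡ (j - j′) * t
          difference = solve-∀

        other-column-inBox : ∀ {j j′} → j ≤ k → j′ ≤ k → j ≢ j′ → ¬ InBox (column j′) → InBox (column j)
        other-column-inBox {j} {j′} j≤k j′≤k j≢j′ ¬hit =
          Sum.[ id , ⊥-elim ∘ ¬hit ]′ (inBox-either (column j) (column j′) (columns-distinct j≤k j′≤k j≢j′))

        inBox₀⇒s₁≡+[1+A]s₀ : InBox (column 0) → ¬ InBox (column k) × + N ∣ + suc A * s₀ - s₁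
        inBox₀⇒s₁≡+[1+A]s₀ hit₀ with column-inBox⇒onAxis z≤n hit₀
        ... | y₀ , y₀≤k , axis₀ =
          ¬hitₖ , subst (+ N ∣_) (cancel (+ suc A) s₀ s₁) (subst (OnAxis 0) y₀≡1 axis₀)
          where
          cancel : ∀ a s t → (a * s + + 0 * t) - (+ 0 * s + + 1 * t) ≡ a * s - t
          cancel = solve-∀
          k₁ : ℕ
          k₁ = ℕ.pred k
          1+k₁≡k : suc k₁ ≡ k
          1+k₁≡k = ℕP.suc-pred k {{ℕ.>-nonZero 1≤k}}
          ¬hitₖ : ¬ InBox (column k)
          ¬hitₖ hitₖ =
            let (y , y≤k , axis) = column-inBox⇒onAxis ℕP.≤-refl hitₖ
            in onAxis⇒≢ axis₀ (sym (m+n≤m⇒n≡0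
                 (subst (_≤ k) (onAxis-aligned z≤n y₀≤k ℕP.≤-refl y≤k axis₀ axis) y≤k)))
          y₀≡1 : y₀ ≡ 1
          y₀≡1 =
            let hitₖ₁ = other-column-inBox ℕP.pred[n]≤n ℕP.≤-refl (ℕP.<⇒≢ (ℕP.≤-reflexive 1+k₁≡k)) ¬hitₖ
                (y , y≤k , axis) = column-inBox⇒onAxis ℕP.pred[n]≤n hitₖ₁
                aligned = onAxis-aligned z≤n y₀≤k ℕP.pred[n]≤n y≤k axis₀ axis
            in ℕP.≤-antisym (m+n≤1+m⇒n≤1 (subst₂ _≤_ aligned (sym 1+k₁≡k) y≤k))
                            (ℕP.n≢0⇒n>0 (onAxis⇒≢ axis₀ ∘ sym))

        inBoxₖ⇒s₁≡-[1+A]s₀ : InBox (column k) → ¬ InBox (column 0) × + N ∣ - + suc A * s₀ - s₁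
        inBoxₖ⇒s₁≡-[1+A]s₀ hitₖ with column-inBox⇒onAxis ℕP.≤-refl hitₖ
        ... | y₀ , y₀≤k , axisₖ =
          ¬hit₀ , subst (+ N ∣_) (cancel (+ suc A) s₀ s₁) (∣m⇒∣-m (subst (OnAxis 1) y≡0 axis₁))
          where
          cancel : ∀ a s t → - ((a * s + + 1 * t) - (+ 0 * s + + 0 * t)) ≡ (- a) * s - t
          cancel = solve-∀
          y₀<k : y₀ < k
          y₀<k = ℕP.≤∧≢⇒< y₀≤k (onAxis⇒≢ axisₖ ∘ sym)
          ¬hit₀ : ¬ InBox (column 0)
          ¬hit₀ hit₀ =
            let (y , y≤k , axis) = column-inBox⇒onAxis z≤n hit₀
            in ℕP.<⇒≱ y₀<k
                 (subst (k ≤_) (onAxis-aligned ℕP.≤-refl y₀≤k z≤n y≤k axisₖ axis) (ℕP.m≤m+n k y))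
          onAxis₁ : Σ ℕ λ y → y ≤ k × OnAxis 1 y
          onAxis₁ = column-inBox⇒onAxis 1≤k (other-column-inBox 1≤k z≤n (λ ()) ¬hit₀)
          y : ℕ
          y = proj₁ onAxis₁
          y≤k : y ≤ k
          y≤k = proj₁ (proj₂ onAxis₁)
          axis₁ : OnAxis 1 y
          axis₁ = proj₂ (proj₂ onAxis₁)
          y≡0 : y ≡ 0
          y≡0 = m+n≤m⇒n≡0 (subst (_≤ k) (sym (onAxis-aligned ℕP.≤-refl y₀≤k 1≤k y≤k axisₖ axis₁)) y₀<k)

        missing-column : Σ ℕ λ j → ¬ InBox (column j) × s₁≡±[1+A]s₀
        missing-column =
          Sum.[ (λ hit₀ → k , Product.map₂ inj₁ (inBox₀⇒s₁≡+[1+A]s₀ hit₀))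
              , (λ hitₖ → 0 , Product.map₂ inj₂ (inBoxₖ⇒s₁≡-[1+A]s₀ hitₖ)) ]′
              (inBox-either (column 0) (column k) (columns-distinct z≤n ℕP.≤-refl (ℕP.<⇒≢ 1≤k)))

        covered : ∀ j → ¬ InBox (column j) → ∀ w → Σ ℕ λ x → Σ ℕ λ y → + N ∣ w - comb x y
        covered j ¬hit w = by-cases (+ N ∣? w - column j)
          where
          by-cases : Dec (+ N ∣ w - column j) → Σ ℕ λ x → Σ ℕ λ y → + N ∣ w - comb x y
          by-cases (yes N∣) = suc A , j , N∣
          by-cases (no N∤)  =
            Sum.[ (λ (x , y , _ , _ , N∣) → x , y , N∣) , ⊥-elim ∘ ¬hit ]′ (inBox-either w (column j) N∤)

        tight-structure : s₁≡±[1+A]s₀ × (∀ w → Σ ℤ λ t → + N ∣ t * s₀ - w)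
        tight-structure =
          let (j , ¬hit , shift) = missing-column
          in shift , λ w → let (x , y , N∣) = covered j ¬hit w
                               (c , N∣cs₀-s₁) = multiplier shift
                           in + x + + y * c , comb∈⟨s₀⟩ x y N∣cs₀-s₁ N∣
          where
          multiplier : s₁≡±[1+A]s₀ → Σ ℤ λ c → + N ∣ c * s₀ - s₁
          multiplier = Sum.[ (+ suc A ,_) , (- + suc A ,_) ]′

  ¬shortRelation⇒box≤ : ∀ {A k a b} → OrderExceeds A (ι a) → OrderExceeds k (ι b) → ¬ ShortRelation A k a b →
                        suc A ℕ.* suc k ≤ N
  ¬shortRelation⇒box≤ {A} {k} {a} {b} ord₀ ord₁ ¬rel = Box.box-size≤ (ι a) (ι b) A k (independent ord₀ ord₁ ¬rel)

  ¬shortRelation∧tight⇒structure :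
    ∀ {A k a b} → OrderExceeds (suc A) (ι a) → OrderExceeds (k ℕ.+ k) (ι b) → 1 ≤ k →
    ¬ ShortRelation A k a b → suc A ℕ.* suc k ≡ N′ →
    (b ≡ smul (+ suc A) a ⊎ b ≡ smul (- + suc A) a) × IsGenerator a
  ¬shortRelation∧tight⇒structure {A} {k} {a} {b} ord₀ ord₁ 1≤k ¬rel tight =
    let (shift , generated) = tight-structure
    in Sum.map (sym ∘ ∣⇒smul≡ (+ suc A) a b) (sym ∘ ∣⇒smul≡ (- + suc A) a b) shift ,
       λ g → Product.map₂ (λ {t} → ∣⇒smul≡ t a g) (generated (ι g))
    where
    indep : Independent A k (ι a) (ι b)
    indep = independent (OrderExceeds-anti (ℕP.n≤1+n A) ord₀) (OrderExceeds-anti (ℕP.m≤m+n k k) ord₁) ¬rel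
    open Box.Tight (ι a) (ι b) A k indep ord₀ ord₁ 1≤k tight using (tight-structure)

open import Data.Nat using (_+_; _*_; _∸_)
open import Data.Nat.Tactic.RingSolver using (solve-∀)

tight-size : ∀ {n k l L} → L + 2 ≡ 2 * n + 2 * l → n ≡ suc k ⊎ l ≡ 1 → L * suc k ≡ n * (2 * k + 2 * l)
tight-size {n} {k} {l} {L} L+2≡ (inj₁ refl) = trans (cong (_* suc k) L≡) (ℕP.*-comm (2 * k + 2 * l) (suc k))
  where
  regroup : ∀ k l → 2 * suc k + 2 * l ≡ (2 * k + 2 * l) + 2
  regroup = solve-∀
  L≡ : L ≡ 2 * k + 2 * l
  L≡ = ℕP.+-cancelʳ-≡ 2 L _ (trans L+2≡ (regroup k l))
tight-size {n} {k} {l} {L} L+2≡ (inj₂ refl) = trans (cong (_* suc k) L≡) (regroup n k)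
  where
  regroup : ∀ n k → 2 * n * suc k ≡ n * (2 * k + 2 * 1)
  regroup = solve-∀
  L≡ : L ≡ 2 * n
  L≡ = ℕP.+-cancelʳ-≡ 2 L (2 * n) L+2≡

oversized : ∀ {n k l L} → L + 2 ≡ 2 * n + 2 * l → n ≤ k → 2 ≤ l → 2 + n * (2 * k + 2 * l) ≤ L * suc k
oversized {n} {k} {l} {L} L+2≡ n≤k 2≤l with ℕP.m≤n⇒∃[o]m+o≡n n≤k | ℕP.m≤n⇒∃[o]m+o≡n 2≤l
... | c , refl | b , refl = subst (2 + n * (2 * (n + c) + 2 * (2 + b)) ≤_) (sym expand) (ℕP.m≤m+n _ _)
  where
  regroup : ∀ n b → 2 * n + 2 * (2 + b) ≡ (2 * n + 2 * b + 2) + 2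
  regroup = solve-∀
  L≡ : L ≡ 2 * n + 2 * b + 2
  L≡ = ℕP.+-cancelʳ-≡ 2 L _ (trans L+2≡ (regroup n b))
  expansion : ∀ n b c → (2 * n + 2 * b + 2) * suc (n + c)
                        ≡ 2 + n * (2 * (n + c) + 2 * (2 + b)) + 2 * (b * c + b + c)
  expansion = solve-∀
  expand : L * suc (n + c) ≡ 2 + n * (2 * (n + c) + 2 * (2 + b)) + 2 * (b * c + b + c)
  expand = trans (cong (_* suc (n + c)) L≡) (expansion n b c)

box-length : ∀ {n} l → 2 ≤ n →
             suc (2 * n + 2 * l ∸ 3) ≡ 2 * n + 2 * l ∸ 2 × suc (2 * n + 2 * l ∸ 3) + 2 ≡ 2 * n + 2 * l
box-length {n} l 2≤n = 1+A≡ , trans (cong (_+ 2) 1+A≡) (ℕP.m∸n+n≡m (ℕP.≤-trans (ℕP.n≤1+n 2) 3≤2n+2l))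
  where
  3≤2n+2l : 3 ≤ 2 * n + 2 * l
  3≤2n+2l = ℕP.≤-trans (ℕP.n≤1+n 3) (ℕP.≤-trans (ℕP.*-monoʳ-≤ 2 2≤n) (ℕP.m≤m+n (2 * n) (2 * l)))
  1+A≡ : suc (2 * n + 2 * l ∸ 3) ≡ 2 * n + 2 * l ∸ 2
  1+A≡ = sym (ℕP.+-∸-assoc 1 3≤2n+2l)

box-length≤ : ∀ {n k l L} → n ≤ suc k → L + 2 ≡ 2 * n + 2 * l → L ≤ k + (k + 2 * l)
box-length≤ {n} {k} {l} {L} n≤1+k L+2≡ =
  ℕP.+-cancelʳ-≤ 2 L _ (subst₂ _≤_ (sym L+2≡) (regroup k l) (ℕP.+-monoˡ-≤ (2 * l) (ℕP.*-monoʳ-≤ 2 n≤1+k)))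
  where
  regroup : ∀ k l → 2 * suc k + 2 * l ≡ k + (k + 2 * l) + 2
  regroup = solve-∀

parameter-cases : ∀ {n k l} → n ≤ suc k → 1 ≤ l → (n ≡ suc k ⊎ l ≡ 1) ⊎ (n ≤ k × 2 ≤ l)
parameter-cases n≤1+k 1≤l with ℕP.m≤n⇒m<n∨m≡n n≤1+k | ℕP.m≤n⇒m<n∨m≡n 1≤l
... | inj₂ n≡1+k | _        = inj₁ (inj₁ n≡1+k)
... | inj₁ _     | inj₂ 1≡l = inj₁ (inj₂ (sym 1≡l))
... | inj₁ n<1+k | inj₁ 1<l = inj₂ (ℕP.≤-pred n<1+k , 1<l)

lemma4p1 : (n k l : ℕ) → 2 ≤ n → n ≤ suc k → 1 ≤ l →
    (S : ZMod (n * (2 * k + 2 * l)) → Set) →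
    Splits (n * (2 * k + 2 * l)) (Interval* (- (+ k)) (+ (k + 2 * l))) S →
    (s s′ : ZMod (n * (2 * k + 2 * l))) → S s → S s′ →
    (Σ ℕ λ x → Σ ℤ λ y →
        1 ≤ x × x ≤ 2 * n + 2 * l ∸ 3 × 1 ≤ ∣ y ∣ × ∣ y ∣ ≤ k ×
        addZ (smul (+ x) s) (smul y s′) ≡ 0Z)
    ⊎ ((s′ ≡ smul (+ (2 * n + 2 * l ∸ 2)) s ⊎ s′ ≡ smul (- (+ (2 * n + 2 * l ∸ 2))) s)
       × (k ≡ n ∸ 1 ⊎ l ≡ 1)
       × IsGenerator s)
lemma4p1 n k l 2≤n n≤1+k 1≤l S splits s s′ Ss Ss′ =
  Sum.map₂ (λ ¬rel → Sum.[ tight-case ¬rel , ⊥-elim ∘ oversized-case ¬rel ]′ (parameter-cases n≤1+k 1≤l))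
           (toSum (shortRelation? A k s s′))
  where
  open Modular (n * (2 * k + 2 * l))
  A : ℕ
  A = 2 * n + 2 * l ∸ 3
  1+A≡ : suc A ≡ 2 * n + 2 * l ∸ 2
  1+A≡ = proj₁ (box-length l 2≤n)
  [1+A]+2≡ : suc A + 2 ≡ 2 * n + 2 * l
  [1+A]+2≡ = proj₂ (box-length l 2≤n)
  order : ∀ {g} → S g → OrderExceeds (k + (k + 2 * l)) (ι g)
  order = splitter-orderExceeds splits (ℕP.≤-trans 1≤l (ℕP.≤-trans (ℕP.m≤m+n l (l + 0)) (ℕP.m≤n+m (2 * l) k)))
  order-s : OrderExceeds (suc A) (ι s)
  order-s = OrderExceeds-anti (box-length≤ {l = l} n≤1+k [1+A]+2≡) (order Ss)
  order-s′ : OrderExceeds (k + k) (ι s′)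
  order-s′ = OrderExceeds-anti (ℕP.+-monoʳ-≤ k (ℕP.m≤m+n k (2 * l))) (order Ss′)
  tight-case : ¬ ShortRelation A k s s′ → n ≡ suc k ⊎ l ≡ 1 →
               (s′ ≡ smul (+ (2 * n + 2 * l ∸ 2)) s ⊎ s′ ≡ smul (- (+ (2 * n + 2 * l ∸ 2))) s)
               × (k ≡ n ∸ 1 ⊎ l ≡ 1) × IsGenerator s
  tight-case ¬rel exact =
    let (shift , generator) = ¬shortRelation∧tight⇒structure order-s order-s′ (ℕP.≤-pred (ℕP.≤-trans 2≤n n≤1+k))
                                                           ¬rel (tight-size [1+A]+2≡ exact)
    in subst (λ L → s′ ≡ smul (+ L) s ⊎ s′ ≡ smul (- + L) s) 1+A≡ shift ,
       Sum.map₁ (λ n≡1+k → cong (_∸ 1) (sym n≡1+k)) exact , generator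
  oversized-case : ¬ ShortRelation A k s s′ → n ≤ k × 2 ≤ l → ⊥
  oversized-case ¬rel (n≤k , 2≤l) =
    ℕP.<⇒≱ (oversized [1+A]+2≡ n≤k 2≤l)
           (¬shortRelation⇒box≤ (OrderExceeds-anti (ℕP.n≤1+n A) order-s)
                                (OrderExceeds-anti (ℕP.m≤m+n k k) order-s′) ¬rel)
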